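{- Every family of sets of solutions contains a unique member $(a,b,c,r,s;x_1,y_1,\dots,x_N,y_N)$ with the following properties: $\gcd(r,sb)=\gcd(s,ra)=1$; $\min(x_1,\dots,x_N)=\min(y_1,\dots,y_N)=0$; and neither $a$ nor $b$ is a perfect power.
   Context: For integers $a>1$, $b>1$, $c>0$, $r>0$, $s>0$, a solution of $(-1)^u r a^x + (-1)^v s b^y = c$ is a quadruple $(x,y,u,v)$ with $x,y$ nonnegative integers and $u,v\in\{0,1\}$; since $(x,y)$ determines $(u,v)$, a solution is referred to by the pair $(x,y)$. A set of solutions, written $(a,b,c,r,s;x_1,y_1,\dots,x_N,y_N)$, is the unordered set of $N>2$ distinct pairs $(x_i,y_i)$, each a solution for the given $a,b,c,r,s$. Two sets of solutions $(a,b,c,r,s;x_1,y_1,\dots,x_N,y_N)$ and $(A,B,C,R,S;X_1,Y_1,\dots,X_N,Y_N)$ are in the same family if $a$ and $A$ are both powers of one integer, $b$ and $B$ are both powers of one integer, and there is a positive rational $k$ with $kc=C$ such that for every $i$ there is $j$ with $kra^{x_i}=RA^{X_j}$ and $ksb^{y_i}=SB^{Y_j}$. A family is an equivalence class under this relation. -}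

module Defs where

open import Data.Bool using (Bool; true; false)
open import Data.Nat as ℕ using (ℕ; zero; suc; _^_; _<_; _≤_; _*_)
open import Data.Nat.GCD using (gcd)
open import Data.Integer as ℤ using (ℤ; +_)
open import Data.Rational as ℚ using (ℚ; Positive)
open import Data.Product using (_×_; _,_; proj₁; proj₂; Σ; ∃; ∃-syntax)
open import Data.List using (List; length)
open import Data.List.Relation.Unary.All using (All)
open import Data.List.Relation.Unary.Any using (Any)
open import Data.List.Relation.Unary.Unique.Propositional using (Unique)
open import Data.List.Membership.Propositional using (_∈_)
open import Data.List.Relation.Binary.Permutation.Propositional using (_↭_)
open import Relation.Binary.PropositionalEquality using (_≡_)
open import Data.Empty using (⊥)

-- (-1)^u as an integer, u ∈ {0,1} encoded as Bool (false = 0, true = 1)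
sgn : Bool → ℤ
sgn false = + 1
sgn true  = ℤ.- (+ 1)

IsSolution : (a b c r s : ℕ) → ℕ × ℕ → Set
IsSolution a b c r s (x , y) =
  ∃[ u ] ∃[ v ] (sgn u ℤ.* (+ (r * a ^ x)) ℤ.+ sgn v ℤ.* (+ (s * b ^ y)) ≡ + c)

-- Raw data of a set of solutions (a,b,c,r,s; x1,y1,...,xN,yN);
-- the pairs are listed in some order (the set is unordered).
record SolSet : Set where
  constructor mkSolSet
  field
    a b c r s : ℕ
    sols      : List (ℕ × ℕ)
open SolSet public

IsSetOfSolutions : SolSet → Set
IsSetOfSolutions S =
  1 < a S × 1 < b S × 0 < c S × 0 < r S × 0 < s S ×
  2 < length (sols S) × Unique (sols S) ×
  All (IsSolution (a S) (b S) (c S) (r S) (s S)) (sols S)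

_≈S_ : SolSet → SolSet → Set
S ≈S T = a S ≡ a T × b S ≡ b T × c S ≡ c T × r S ≡ r T × s S ≡ s T × sols S ↭ sols T

PowersOfOne : ℕ → ℕ → Set
PowersOfOne m n = ∃[ g ] ∃[ i ] ∃[ j ] (m ≡ g ^ i × n ≡ g ^ j)

toℚ : ℕ → ℚ
toℚ n = (+ n) ℚ./ 1

SameFamily : SolSet → SolSet → Set
SameFamily S T =
  length (sols S) ≡ length (sols T) ×
  PowersOfOne (a S) (a T) × PowersOfOne (b S) (b T) ×
  ∃[ k ] (Positive k × k ℚ.* toℚ (c S) ≡ toℚ (c T) ×
    All (λ p → Any (λ q →
            k ℚ.* toℚ (r S * a S ^ proj₁ p) ≡ toℚ (r T * a T ^ proj₁ q) ×
            k ℚ.* toℚ (s S * b S ^ proj₂ p) ≡ toℚ (s T * b T ^ proj₂ q))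
          (sols T))
        (sols S))

IsPerfectPower : ℕ → Set
IsPerfectPower n = ∃[ m ] ∃[ k ] (2 ≤ k × n ≡ m ^ k)

IsBasic : SolSet → Set
IsBasic S =
  gcd (r S) (s S * b S) ≡ 1 × gcd (s S) (r S * a S) ≡ 1 ×
  Any (λ p → proj₁ p ≡ 0) (sols S) ×   -- min x_i = 0
  Any (λ p → proj₂ p ≡ 0) (sols S) ×   -- min y_i = 0
  (IsPerfectPower (a S) → ⊥) × (IsPerfectPower (b S) → ⊥)

-- Write a = A^m and b = B^n with A, B not perfect powers, let δ and ε be the least x and y
-- occurring, and divide r a^δ and s b^ε by their gcd d to get coprime R and S.  Every
-- solution (x, y) then becomes the solution (m (x − δ), n (y − ε)) of
-- ± R A^X ± S B^Y = c / d, and this normalised set lies in the family.  It is basic: a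
-- common divisor of R and B divides S, since either some solution has y > 0 (so the divisor
-- divides c, and then S via a solution with y = 0), or all solutions have y = 0 and
-- R A^x would take at most the two values |c ∓ S| at three distinct x.
-- Conversely, a basic member of the family has bases A and B (a non-perfect power among the
-- powers of one integer is unique), and is related to the normalised set by a scaling
-- M (R A^X) = D (R′ A^X′).  Counting shows the relation pairs the two lists bijectively;
-- comparing the pairs with X = 0 or X′ = 0 forces M R = D R′, likewise M S = D S′, and
-- coprimality gives R = R′, S = S′, M = D, so the relation is equality.
{-# OPTIONS --safe #-}
module Submission where

open import Defs
open import Data.Bool using (Bool; true; false)
open import Data.Integer as ℤ using (+_; +[1+_])
import Data.Integer.Divisibility.Signed as ℤ∣
import Data.Integer.Properties as ℤ
open import Data.Integer.Solver using (module +-*-Solver)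
open import Data.List using (List; []; _∷_; _++_; length; map)
open import Data.List.Extrema.Nat using (argmin; argmin-all; f[argmin]≤f[⊤]; f[argmin]≤f[xs])
open import Data.List.Membership.Propositional using (_∈_; find; lose)
open import Data.List.Membership.Propositional.Properties using (∈-∃++)
open import Data.List.Properties using (length-map)
open import Data.List.Relation.Binary.Permutation.Propositional using (_↭_; prep; ↭-refl; ↭-sym; ↭-trans)
open import Data.List.Relation.Binary.Permutation.Propositional.Properties using (∈-resp-↭; ↭-length; shift)
open import Data.List.Relation.Binary.Subset.Propositional using (_⊆_)
open import Data.List.Relation.Unary.All as All using (All; []; _∷_; all?)
import Data.List.Relation.Unary.All.Properties as All
open import Data.List.Relation.Unary.Any as Any using (Any; here; there)
import Data.List.Relation.Unary.Any.Properties as Any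
open import Data.List.Relation.Unary.Unique.Propositional using (Unique)
open import Data.List.Relation.Unary.AllPairs using ([]; _∷_)
open import Data.List.Relation.Unary.Unique.Propositional.Properties using (Unique[x∷xs]⇒x∉xs)
import Data.List.Relation.Unary.Unique.Propositional.Properties as Unique
open import Data.Nat as ℕ using (ℕ; zero; suc; _+_; _*_; _∸_; _^_; _≤_; _<_; z≤n; s≤s; z<s; NonZero; >-nonZero; _≟_; _≤?_)
open import Data.Nat.Coprimality as Coprime using (Coprime; coprime-divisor; coprime-/gcd; coprime⇒gcd≡1; gcd≡1⇒coprime; 1-coprimeTo)
open import Data.Nat.DivMod using (_/_; m/n*n≡m)
open import Data.Nat.Divisibility using (_∣_; divides; ∣-refl; ∣-trans; ∣-antisym; ∣1⇒≡1; ∣m⇒∣m*n; ∣n⇒∣m*n; *-cancelʳ-∣)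
open import Data.Nat.GCD using (gcd; gcd[m,n]∣m; gcd[m,n]∣n; gcd[m,n]≢0)
open import Data.Nat.Properties
open import Algebra.Properties.CommutativeSemigroup *-commutativeSemigroup using (interchange; xy∙z≈xz∙y)
open import Data.Product using (_×_; _,_; proj₁; proj₂; ∃; ∃-syntax)
import Data.Product as Product
open import Data.Rational as ℚ using (mkℚ; ↥_; ↧_; toℚᵘ; Positive)
import Data.Rational.Properties as ℚ
open import Data.Rational.Unnormalised as ℚᵘ using (mkℚᵘ; *≡*) renaming (_≃_ to _≃ᵘ_)
import Data.Rational.Unnormalised.Properties as ℚᵘ
open import Function using (_∘′_)
open import Data.Sum using (_⊎_; inj₁; inj₂)
open import Relation.Binary.Definitions using (tri<; tri≈; tri>)
open import Relation.Binary.PropositionalEquality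
open import Relation.Nullary using (¬_; Dec; yes; no; contradiction)
open import Relation.Nullary.Decidable using (map′; _×-dec_)

module _ {A : Set} where

  Unique-⊆⇒↭ : ∀ {xs ys : List A} → Unique xs → xs ⊆ ys → length ys ≤ length xs → xs ↭ ys
  Unique-⊆⇒↭ {[]} {[]} _ _ _ = ↭-refl
  Unique-⊆⇒↭ {x ∷ xs} {ys} x∷xs-unique@(_ ∷ xs-unique) x∷xs⊆ys len
    with h , t , refl ← ∈-∃++ (x∷xs⊆ys (here refl)) =
    ↭-trans (prep x (Unique-⊆⇒↭ xs-unique xs⊆h++t len′)) (↭-sym (shift x h t))
    where
    xs⊆h++t : xs ⊆ h ++ t
    xs⊆h++t z∈xs with ∈-resp-↭ (shift x h t) (x∷xs⊆ys (there z∈xs))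
    ... | here refl = contradiction z∈xs (Unique[x∷xs]⇒x∉xs x∷xs-unique)
    ... | there z∈h++t = z∈h++t
    len′ : length (h ++ t) ≤ length xs
    len′ = ≤-pred (subst (_≤ suc (length xs)) (↭-length (shift x h t)) len)

  Unique-map⁺-∈ : ∀ {B : Set} (f : A → B) {xs} →
    (∀ {x y} → x ∈ xs → y ∈ xs → f x ≡ f y → x ≡ y) → Unique xs → Unique (map f xs)
  Unique-map⁺-∈ f {[]} _ [] = []
  Unique-map⁺-∈ f {x ∷ xs} injective (x∉xs ∷ xs-unique) =
    All.map⁺ (All.tabulate λ y∈xs fx≡fy → All.lookup x∉xs y∈xs (injective (here refl) (there y∈xs) fx≡fy))
    ∷ Unique-map⁺-∈ f (λ x∈ y∈ → injective (there x∈) (there y∈)) xs-unique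

  record Minimiser (f : A → ℕ) (xs : List A) : Set where
    field
      point : A
      point∈ : point ∈ xs
      minimal : All (λ p → f point ≤ f p) xs

  minimiser : (f : A → ℕ) (xs : List A) → 0 < length xs → Minimiser f xs
  minimiser f (p ∷ ps) _ = record
    { point = argmin f p ps
    ; point∈ = argmin-all f {P = _∈ p ∷ ps} (here refl) (All.tabulate there)
    ; minimal = f[argmin]≤f[⊤] {f = f} p ps ∷ f[argmin]≤f[xs] {f = f} p ps
    }

module _ {A B : Set} (R : A → B → Set) (R-injective : ∀ {t t′ q} → R t q → R t′ q → t ≡ t′) where

  private
    partners : ∀ {ts qs} → All (λ t → Any (R t) qs) ts → List B
    partners [] = []
    partners (t~ ∷ ts~) = proj₁ (find t~) ∷ partners ts~

    partners-sound : ∀ {ts qs} (ts~ : All (λ t → Any (R t) qs) ts) {q} →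
      q ∈ partners ts~ → q ∈ qs × ∃[ t ] (t ∈ ts × R t q)
    partners-sound (t~ ∷ _) (here refl) = let _ , q∈ , Rtq = find t~ in q∈ , _ , here refl , Rtq
    partners-sound (_ ∷ ts~) (there q∈) =
      let q∈qs , t , t∈ , Rtq = partners-sound ts~ q∈ in q∈qs , t , there t∈ , Rtq

    length-partners : ∀ {ts qs} (ts~ : All (λ t → Any (R t) qs) ts) → length (partners ts~) ≡ length ts
    length-partners [] = refl
    length-partners (_ ∷ ts~) = cong suc (length-partners ts~)

    Unique-partners : ∀ {ts qs} (ts~ : All (λ t → Any (R t) qs) ts) → Unique ts → Unique (partners ts~)
    Unique-partners [] [] = []
    Unique-partners (t~ ∷ ts~) (t∉ts ∷ ts-unique) =
      All.tabulate (λ q∈ q₀≡q →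
        let _ , t′∈ , Rt′q = proj₂ (partners-sound ts~ q∈)
        in All.lookup t∉ts t′∈ (R-injective (subst (R _) q₀≡q (proj₂ (proj₂ (find t~)))) Rt′q))
      ∷ Unique-partners ts~ ts-unique

  All-Any⇒onto : ∀ {ts qs} → Unique ts → length qs ≤ length ts →
    All (λ t → Any (R t) qs) ts → ∀ {q} → q ∈ qs → ∃[ t ] (t ∈ ts × R t q)
  All-Any⇒onto {ts} {qs} ts-unique len ts~ q∈qs =
    proj₂ (partners-sound ts~ (∈-resp-↭ (↭-sym partners↭qs) q∈qs))
    where
    partners↭qs : partners ts~ ↭ qs
    partners↭qs = Unique-⊆⇒↭ (Unique-partners ts~ ts-unique) (proj₁ ∘′ partners-sound ts~)
      (subst (length qs ≤_) (sym (length-partners ts~)) len)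

0<*⁺ : ∀ {m n} → 0 < m → 0 < n → 0 < m * n
0<*⁺ {suc _} {suc _} _ _ = z<s

0<*⁻ : ∀ {m n} → 0 < m * n → 0 < m
0<*⁻ {suc _} _ = z<s

^-distribʳ-* : ∀ m n i → (m * n) ^ i ≡ m ^ i * n ^ i
^-distribʳ-* m n zero = refl
^-distribʳ-* m n (suc i) =
  trans (cong (m * n *_) (^-distribʳ-* m n i)) (interchange m n (m ^ i) (n ^ i))

^-injectiveʳ : ∀ {g i j} → 1 < g → g ^ i ≡ g ^ j → i ≡ j
^-injectiveʳ {g} {i} {j} 1<g gⁱ≡gʲ with <-cmp i j
... | tri< i<j _ _ = contradiction gⁱ≡gʲ (<⇒≢ (^-monoʳ-< g 1<g i<j))
... | tri≈ _ i≡j _ = i≡j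
... | tri> _ _ j<i = contradiction gⁱ≡gʲ (>⇒≢ (^-monoʳ-< g 1<g j<i))

^-injectiveˡ : ∀ {g h i} → 0 < i → g ^ i ≡ h ^ i → g ≡ h
^-injectiveˡ {g} {h} {i} 0<i gⁱ≡hⁱ with <-cmp g h
... | tri< g<h _ _ = contradiction gⁱ≡hⁱ (<⇒≢ (^-monoˡ-< i {{>-nonZero 0<i}} g<h))
... | tri≈ _ g≡h _ = g≡h
... | tri> _ _ h<g = contradiction gⁱ≡hⁱ (>⇒≢ (^-monoˡ-< i {{>-nonZero 0<i}} h<g))

*^-injective : ∀ {m g i j} → 0 < m → 1 < g → m * g ^ i ≡ m * g ^ j → i ≡ j
*^-injective {m} {g} {i} {j} 0<m 1<g e = ^-injectiveʳ 1<g (*-cancelˡ-≡ (g ^ i) (g ^ j) m {{>-nonZero 0<m}} e)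

1<m^n⇒1<m : ∀ m n → 1 < m ^ n → 1 < m
1<m^n⇒1<m 0 0 (s≤s ())
1<m^n⇒1<m 0 (suc n) ()
1<m^n⇒1<m 1 n 1<1ⁿ = contradiction (^-zeroˡ n) (>⇒≢ 1<1ⁿ)
1<m^n⇒1<m (suc (suc m)) n _ = s≤s z<s

1<m^n⇒0<n : ∀ m n → 1 < m ^ n → 0 < n
1<m^n⇒0<n m zero (s≤s ())
1<m^n⇒0<n m (suc n) _ = z<s

n<m^n : ∀ {m} n → 1 < m → n < m ^ n
n<m^n zero _ = z<s
n<m^n {m} (suc n) 1<m = ≤-<-trans (n<m^n n 1<m) (^-monoʳ-< m 1<m (n<1+n n))

-- n·gⁱ⁺ʲ = m·gʲ = n, so i = 0.
*^-balance : ∀ {g m n i j} → 1 < g → 0 < n → m * g ^ 0 ≡ n * g ^ i → m * g ^ j ≡ n * g ^ 0 → m ≡ n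
*^-balance {g} {m} {n} {i} {j} 1<g 0<n mg⁰≡ngⁱ mgʲ≡ng⁰ =
  trans (sym (*-identityʳ m)) (trans mg⁰≡ngⁱ (trans (cong (λ k → n * g ^ k) i≡0) (*-identityʳ n)))
  where
  open ≡-Reasoning
  i+j≡0 : i + j ≡ 0
  i+j≡0 = *^-injective 0<n 1<g (begin
    n * g ^ (i + j)      ≡⟨ cong (n *_) (^-distribˡ-+-* g i j) ⟩
    n * (g ^ i * g ^ j)  ≡⟨ sym (*-assoc n _ _) ⟩
    n * g ^ i * g ^ j    ≡⟨ cong (_* g ^ j) (trans (sym mg⁰≡ngⁱ) (*-identityʳ m)) ⟩
    m * g ^ j            ≡⟨ mgʲ≡ng⁰ ⟩
    n * g ^ 0            ∎)
  i≡0 : i ≡ 0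
  i≡0 = m+n≡0⇒m≡0 i i+j≡0

coprime-*ʳ : ∀ {m n o} → Coprime m n → Coprime m o → Coprime m (n * o)
coprime-*ʳ m⊥n m⊥o (d∣m , d∣no) =
  m⊥o (d∣m , coprime-divisor (λ (e∣d , e∣n) → m⊥n (∣-trans e∣d d∣m , e∣n)) d∣no)

coprime-^ʳ : ∀ {m n} i → Coprime m n → Coprime m (n ^ i)
coprime-^ʳ zero _ (_ , d∣1) = ∣1⇒≡1 d∣1
coprime-^ʳ (suc i) m⊥n = coprime-*ʳ m⊥n (coprime-^ʳ i m⊥n)

record CoprimeSplit (m n : ℕ) : Set where
  field
    d m′ n′ : ℕ
    0<d : 0 < d
    m≡m′*d : m ≡ m′ * d
    n≡n′*d : n ≡ n′ * d
    m′⊥n′ : Coprime m′ n′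

coprimeSplit : ∀ m n → 0 < m → CoprimeSplit m n
coprimeSplit m n 0<m = record
  { d = gcd m n
  ; m′ = m / gcd m n
  ; n′ = n / gcd m n
  ; 0<d = ℕ.>-nonZero⁻¹ (gcd m n)
  ; m≡m′*d = sym (m/n*n≡m (gcd[m,n]∣m m n))
  ; n≡n′*d = sym (m/n*n≡m (gcd[m,n]∣n m n))
  ; m′⊥n′ = coprime-/gcd m n
  }
  where
  instance
    gcd≢0 : NonZero (gcd m n)
    gcd≢0 = ℕ.≢-nonZero (gcd[m,n]≢0 m n (inj₁ (m<n⇒n≢0 0<m)))

m^k∣n^k⇒m∣n : ∀ {m n} k → 0 < k → 0 < m → m ^ k ∣ n ^ k → m ∣ n
m^k∣n^k⇒m∣n {m} {n} k 0<k 0<m mᵏ∣nᵏ = subst (_∣ n) (sym m≡d) (divides n′ n≡n′*d)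
  where
  open CoprimeSplit (coprimeSplit m n 0<m)
  instance
    dᵏ≢0 : NonZero (d ^ k)
    dᵏ≢0 = m^n≢0 d k {{>-nonZero 0<d}}
  ^k-split : ∀ {x x′} → x ≡ x′ * d → x ^ k ≡ x′ ^ k * d ^ k
  ^k-split {x′ = x′} x≡x′d = trans (cong (_^ k) x≡x′d) (^-distribʳ-* x′ d k)
  m′ᵏ≡1 : m′ ^ k ≡ 1
  m′ᵏ≡1 = coprime-^ʳ k (Coprime.sym (coprime-^ʳ k (Coprime.sym m′⊥n′)))
    (∣-refl , *-cancelʳ-∣ (d ^ k) (subst₂ _∣_ (^k-split m≡m′*d) (^k-split n≡n′*d) mᵏ∣nᵏ))
  m′≡1 : m′ ≡ 1
  m′≡1 with m^n≡1⇒n≡0∨m≡1 m′ k m′ᵏ≡1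
  ... | inj₁ k≡0 = contradiction k≡0 (m<n⇒n≢0 0<k)
  ... | inj₂ m′≡1 = m′≡1
  m≡d : m ≡ d
  m≡d = trans m≡m′*d (trans (cong (_* d) m′≡1) (*-identityˡ d))

^≡^-descent : ∀ {g h i j} → 0 < h → suc i < j → g ^ suc i ≡ h ^ j →
  ∃[ t ] (g ≡ t * h × t ^ suc i ≡ h ^ (j ∸ suc i))
^≡^-descent {g} {h} {i} {j} 0<h k<j gᵏ≡hʲ = t , g≡t*h , *-cancelʳ-≡ (t ^ k) (h ^ (j ∸ k)) (h ^ k) tᵏhᵏ≡hʲ⁻ᵏhᵏ
  where
  open ≡-Reasoning
  k = suc i
  instance
    hᵏ≢0 : NonZero (h ^ k)
    hᵏ≢0 = m^n≢0 h k {{>-nonZero 0<h}}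
  gᵏ≡hʲ⁻ᵏhᵏ : g ^ k ≡ h ^ (j ∸ k) * h ^ k
  gᵏ≡hʲ⁻ᵏhᵏ = trans gᵏ≡hʲ (trans (cong (h ^_) (sym (m∸n+n≡m (<⇒≤ k<j)))) (^-distribˡ-+-* h (j ∸ k) k))
  open _∣_ (m^k∣n^k⇒m∣n {h} {g} k z<s 0<h (divides (h ^ (j ∸ k)) gᵏ≡hʲ⁻ᵏhᵏ)) renaming (quotient to t; equality to g≡t*h)
  tᵏhᵏ≡hʲ⁻ᵏhᵏ : t ^ k * h ^ k ≡ h ^ (j ∸ k) * h ^ k
  tᵏhᵏ≡hʲ⁻ᵏhᵏ = begin
    t ^ k * h ^ k  ≡⟨ sym (^-distribʳ-* t h k) ⟩
    (t * h) ^ k    ≡⟨ cong (_^ k) g≡t*h ⟨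
    g ^ k          ≡⟨ gᵏ≡hʲ⁻ᵏhᵏ ⟩
    h ^ (j ∸ k) * h ^ k ∎

CommonBase : ℕ → ℕ → Set
CommonBase g h = ∃[ t ] ∃[ p ] ∃[ q ] (0 < p × 0 < q × g ≡ t ^ p × h ≡ t ^ q)

CommonBase-sym : ∀ {g h} → CommonBase g h → CommonBase h g
CommonBase-sym (t , p , q , 0<p , 0<q , g≡tᵖ , h≡tᑫ) = t , q , p , 0<q , 0<p , h≡tᑫ , g≡tᵖ

-- The exponent sum i + j is bounded by the explicit measure n, which decreases at each step
-- of the Euclidean descent (i, j) ↦ (i, j − i).
^≡^⇒commonBase : ∀ n {g h i j} → i + j ≤ n → 1 < g → 1 < h → 0 < i → 0 < j → g ^ i ≡ h ^ j →
  CommonBase g h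
^≡^⇒commonBase-< : ∀ n {g h i j} → i + j ≤ suc n → 1 < g → 1 < h → 0 < i → i < j → g ^ i ≡ h ^ j →
  CommonBase g h

^≡^⇒commonBase zero {i = suc _} () _ _ _ _ _
^≡^⇒commonBase (suc n) {g} {h} {i} {j} i+j≤ 1<g 1<h 0<i 0<j gⁱ≡hʲ with <-cmp i j
... | tri< i<j _ _ = ^≡^⇒commonBase-< n i+j≤ 1<g 1<h 0<i i<j gⁱ≡hʲ
... | tri≈ _ refl _ =
  g , 1 , 1 , z<s , z<s , sym (^-identityʳ g) , trans (sym (^-injectiveˡ 0<i gⁱ≡hʲ)) (sym (^-identityʳ g))
... | tri> _ _ j<i =
  CommonBase-sym (^≡^⇒commonBase-< n (subst (_≤ suc n) (+-comm i j) i+j≤) 1<h 1<g 0<j j<i (sym gⁱ≡hʲ))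

^≡^⇒commonBase-< n {g} {h} {suc i} {j} i+j≤ 1<g 1<h _ i<j gⁱ≡hʲ = via (^≡^-descent (<-trans z<s 1<h) i<j gⁱ≡hʲ)
  where
  0<j∸i : 0 < j ∸ suc i
  0<j∸i = m<n⇒0<n∸m i<j
  i+[j∸i]≤n : suc i + (j ∸ suc i) ≤ n
  i+[j∸i]≤n = subst (_≤ n) (sym (m+[n∸m]≡n (<⇒≤ i<j))) (≤-trans (m≤n+m j i) (≤-pred i+j≤))
  via : ∃[ t ] (g ≡ t * h × t ^ suc i ≡ h ^ (j ∸ suc i)) → CommonBase g h
  via (t , g≡t*h , tⁱ≡hʲ⁻ⁱ) = extend (^≡^⇒commonBase n i+[j∸i]≤n 1<t 1<h z<s 0<j∸i tⁱ≡hʲ⁻ⁱ)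
    where
    1<t : 1 < t
    1<t = 1<m^n⇒1<m t (suc i) (subst (1 <_) (sym tⁱ≡hʲ⁻ⁱ) (^-monoʳ-< h 1<h 0<j∸i))
    extend : CommonBase t h → CommonBase g h
    extend (u , p , q , 0<p , 0<q , t≡uᵖ , h≡uᑫ) = u , p + q , q , ≤-trans 0<p (m≤m+n p q) , 0<q ,
      trans g≡t*h (trans (cong₂ _*_ t≡uᵖ h≡uᑫ) (sym (^-distribˡ-+-* u p q))) , h≡uᑫ

¬perfect-^⇒≡ : ∀ {g t p} → ¬ IsPerfectPower g → 0 < p → g ≡ t ^ p → g ≡ t
¬perfect-^⇒≡ {t = t} {p = 1} _ _ g≡t¹ = trans g≡t¹ (^-identityʳ t)
¬perfect-^⇒≡ {t = t} {p = suc (suc p)} ¬perfect _ g≡tᵖ = contradiction (t , suc (suc p) , s≤s (s≤s z≤n) , g≡tᵖ) ¬perfect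

¬perfect-^≡^⇒≡ : ∀ {g h i j} → ¬ IsPerfectPower g → ¬ IsPerfectPower h → 1 < g → 1 < h → 0 < i → 0 < j →
  g ^ i ≡ h ^ j → g ≡ h
¬perfect-^≡^⇒≡ {i = i} {j} ¬perfect-g ¬perfect-h 1<g 1<h 0<i 0<j gⁱ≡hʲ
  with _ , _ , _ , 0<p , 0<q , g≡tᵖ , h≡tᑫ ← ^≡^⇒commonBase (i + j) ≤-refl 1<g 1<h 0<i 0<j gⁱ≡hʲ
  = trans (¬perfect-^⇒≡ ¬perfect-g 0<p g≡tᵖ) (sym (¬perfect-^⇒≡ ¬perfect-h 0<q h≡tᑫ))

-- A witness n = m^k has m ≤ n and k < n, so the search is finite.
perfectPower? : ∀ n → 1 < n → Dec (IsPerfectPower n)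
perfectPower? n 1<n =
  map′ (λ (m , _ , k , _ , 2≤k , n≡mᵏ) → m , k , 2≤k , n≡mᵏ) bounded
    (anyUpTo? (λ m → anyUpTo? (λ k → (2 ≤? k) ×-dec (n ≟ m ^ k)) (suc n)) (suc n))
  where
  bounded : IsPerfectPower n → ∃ λ m → m < suc n × ∃ λ k → k < suc n × (2 ≤ k × n ≡ m ^ k)
  bounded (m , k , 2≤k , n≡mᵏ) = m , s≤s m≤n , k , s≤s (<⇒≤ k<n) , 2≤k , n≡mᵏ
    where
    1<m : 1 < m
    1<m = 1<m^n⇒1<m m k (subst (1 <_) n≡mᵏ 1<n)
    m≤n : m ≤ n
    m≤n = subst₂ _≤_ (^-identityʳ m) (sym n≡mᵏ) (^-monoʳ-≤ m {{>-nonZero (<-trans z<s 1<m)}} (<-trans z<s 2≤k))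
    k<n : k < n
    k<n = subst (k <_) (sym n≡mᵏ) (n<m^n k 1<m)

record PrimitiveBase (n : ℕ) : Set where
  field
    base exponent : ℕ
    1<base : 1 < base
    0<exponent : 0 < exponent
    n≡base^exponent : n ≡ base ^ exponent
    base-¬perfect : ¬ IsPerfectPower base

primitiveBase : ∀ {n} → 1 < n → PrimitiveBase n
primitiveBase {n} = go n ≤-refl
  where
  go : ∀ fuel {n} → n ≤ fuel → 1 < n → PrimitiveBase n
  go zero z≤n ()
  go (suc fuel) {n} n≤fuel 1<n with perfectPower? n 1<n
  ... | no ¬perfect = record
    { base = n ; exponent = 1 ; 1<base = 1<n ; 0<exponent = z<s
    ; n≡base^exponent = sym (^-identityʳ n) ; base-¬perfect = ¬perfect }
  ... | yes (m , k , 2≤k , n≡mᵏ) = record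
    { base = base ; exponent = exponent * k ; 1<base = 1<base
    ; 0<exponent = 0<*⁺ 0<exponent (<-trans z<s 2≤k)
    ; n≡base^exponent = trans n≡mᵏ (trans (cong (_^ k) n≡base^exponent) (^-*-assoc base exponent k))
    ; base-¬perfect = base-¬perfect }
    where
    1<m : 1 < m
    1<m = 1<m^n⇒1<m m k (subst (1 <_) n≡mᵏ 1<n)
    m<n : m < n
    m<n = subst₂ _<_ (^-identityʳ m) (sym n≡mᵏ) (^-monoʳ-< m 1<m 2≤k)
    open PrimitiveBase (go fuel (≤-pred (≤-trans m<n n≤fuel)) 1<m)

PowersOfOne⇒≡base : ∀ {a a′} (P : PrimitiveBase a) → 1 < a′ → ¬ IsPerfectPower a′ → PowersOfOne a a′ →
  a′ ≡ PrimitiveBase.base P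
PowersOfOne⇒≡base {a} {a′} P 1<a′ a′-¬perfect (g , i , j , a≡gⁱ , a′≡gʲ) =
  via (^≡^⇒commonBase (m + i) ≤-refl 1<A 1<g 0<m 0<i Aᵐ≡gⁱ)
  where
  open PrimitiveBase P renaming (base to A; exponent to m; 1<base to 1<A; 0<exponent to 0<m)
  Aᵐ≡gⁱ : A ^ m ≡ g ^ i
  Aᵐ≡gⁱ = trans (sym n≡base^exponent) a≡gⁱ
  1<gⁱ : 1 < g ^ i
  1<gⁱ = subst (1 <_) Aᵐ≡gⁱ (^-monoʳ-< A 1<A 0<m)
  1<g : 1 < g
  1<g = 1<m^n⇒1<m g i 1<gⁱ
  0<i : 0 < i
  0<i = 1<m^n⇒0<n g i 1<gⁱ
  0<j : 0 < j
  0<j = 1<m^n⇒0<n g j (subst (1 <_) a′≡gʲ 1<a′)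
  via : CommonBase A g → a′ ≡ A
  via (t , p , q , 0<p , 0<q , A≡tᵖ , g≡tᑫ) =
    ¬perfect-^≡^⇒≡ a′-¬perfect base-¬perfect 1<a′ 1<A 0<p (0<*⁺ 0<q 0<j) (begin
      a′ ^ p              ≡⟨ cong (_^ p) (trans a′≡gʲ (cong (_^ j) g≡tᑫ)) ⟩
      ((t ^ q) ^ j) ^ p   ≡⟨ cong (_^ p) (^-*-assoc t q j) ⟩
      (t ^ (q * j)) ^ p   ≡⟨ ^-*-assoc t (q * j) p ⟩
      t ^ (q * j * p)     ≡⟨ cong (t ^_) (*-comm (q * j) p) ⟩
      t ^ (p * (q * j))   ≡⟨ ^-*-assoc t p (q * j) ⟨
      (t ^ p) ^ (q * j)   ≡⟨ cong (_^ (q * j)) A≡tᵖ ⟨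
      A ^ (q * j)         ∎)
    where open ≡-Reasoning

toℚᵘ-toℚ : ∀ n → toℚᵘ (toℚ n) ≃ᵘ mkℚᵘ (+ n) 0
toℚᵘ-toℚ n = ℚ.toℚᵘ-fromℚᵘ (mkℚᵘ (+ n) 0)

toℚᵘ-*toℚ : ∀ k n → toℚᵘ (k ℚ.* toℚ n) ≃ᵘ toℚᵘ k ℚᵘ.* mkℚᵘ (+ n) 0
toℚᵘ-*toℚ k n = ℚᵘ.≃-trans (ℚ.toℚᵘ-homo-* k (toℚ n)) (ℚᵘ.*-congˡ {toℚᵘ k} (toℚᵘ-toℚ n))

*toℚ≡toℚ⇒ : ∀ k {m n} → k ℚ.* toℚ m ≡ toℚ n → ↥ k ℤ.* + m ℤ.* + 1 ≡ + n ℤ.* (↧ k ℤ.* + 1)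
*toℚ≡toℚ⇒ k@record{} {m} {n} k*m≡n
  with *≡* e ← ℚᵘ.≃-trans (ℚᵘ.≃-sym (toℚᵘ-*toℚ k m)) (ℚᵘ.≃-trans (ℚ.toℚᵘ-cong k*m≡n) (toℚᵘ-toℚ n)) = e

*toℚ≡toℚ⇐ : ∀ k {m n} → ↥ k ℤ.* + m ℤ.* + 1 ≡ + n ℤ.* (↧ k ℤ.* + 1) → k ℚ.* toℚ m ≡ toℚ n
*toℚ≡toℚ⇐ k@record{} {m} {n} e =
  ℚ.toℚᵘ-injective (ℚᵘ.≃-trans (toℚᵘ-*toℚ k m) (ℚᵘ.≃-trans (*≡* e) (ℚᵘ.≃-sym (toℚᵘ-toℚ n))))

positive-ratio : ∀ k → Positive k →
  ∃[ N ] ∃[ D ] (0 < N × 0 < D × ∀ {m n} → k ℚ.* toℚ m ≡ toℚ n → N * m ≡ D * n)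
positive-ratio k@(mkℚ +[1+ N ] D _) _ = suc N , suc D , z<s , z<s , λ {m} {n} k*m≡n →
  ℤ.+-injective (begin
    + (suc N * m)               ≡⟨ ℤ.pos-* (suc N) m ⟩
    + suc N ℤ.* + m             ≡⟨ ℤ.*-identityʳ _ ⟨
    + suc N ℤ.* + m ℤ.* + 1     ≡⟨ *toℚ≡toℚ⇒ k {m} {n} k*m≡n ⟩
    + n ℤ.* (+ suc D ℤ.* + 1)   ≡⟨ cong (+ n ℤ.*_) (ℤ.*-identityʳ _) ⟩
    + n ℤ.* + suc D             ≡⟨ ℤ.*-comm (+ n) _ ⟩
    + suc D ℤ.* + n             ≡⟨ ℤ.pos-* (suc D) n ⟨
    + (suc D * n)               ∎)
  where open ≡-Reasoning

reciprocal : ∀ d → 0 < d → ∃[ k ] (Positive k × ∀ {m n} → m ≡ n * d → k ℚ.* toℚ m ≡ toℚ n)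
reciprocal (suc d) _ = k , _ , λ {m} {n} m≡nd → *toℚ≡toℚ⇐ k {m} {n} (begin
    + 1 ℤ.* + m ℤ.* + 1         ≡⟨ ℤ.*-identityʳ _ ⟩
    + 1 ℤ.* + m                 ≡⟨ ℤ.*-identityˡ _ ⟩
    + m                         ≡⟨ cong +_ m≡nd ⟩
    + (n * suc d)               ≡⟨ ℤ.pos-* n (suc d) ⟩
    + n ℤ.* + suc d             ≡⟨ cong (+ n ℤ.*_) (ℤ.*-identityʳ _) ⟨
    + n ℤ.* (+ suc d ℤ.* + 1)   ∎)
  where
  open ≡-Reasoning
  k = mkℚ (+ 1) d (1-coprimeTo (suc d))

∣sgn*∣ : ∀ u z → ℤ.∣ sgn u ℤ.* z ∣ ≡ ℤ.∣ z ∣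
∣sgn*∣ false z = cong ℤ.∣_∣ (ℤ.*-identityˡ z)
∣sgn*∣ true z = trans (cong ℤ.∣_∣ (ℤ.-1*i≡-i z)) (ℤ.∣-i∣≡∣i∣ z)

∣⇒∣sgn* : ∀ {g} u n → g ∣ n → + g ℤ∣.∣ sgn u ℤ.* + n
∣⇒∣sgn* {g} u n g∣n = ℤ∣.∣ᵤ⇒∣ (subst (g ∣_) (sym (∣sgn*∣ u (+ n))) g∣n)

∣sgn*⇒∣ : ∀ {g} u n → + g ℤ∣.∣ sgn u ℤ.* + n → g ∣ n
∣sgn*⇒∣ {g} u n g∣±n = subst (g ∣_) (∣sgn*∣ u (+ n)) (ℤ∣.∣⇒∣ᵤ g∣±n)

∣⇒∣^ : ∀ {g b y} → y ≢ 0 → g ∣ b → g ∣ b ^ y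
∣⇒∣^ {y = zero} 0≢0 _ = contradiction refl 0≢0
∣⇒∣^ {b = b} {y = suc y} _ g∣b = ∣m⇒∣m*n (b ^ y) g∣b

Solution : SolSet → ℕ × ℕ → Set
Solution U = IsSolution (a U) (b U) (c U) (r U) (s U)

solution-∣c : ∀ U {g} p → Solution U p → g ∣ r U * a U ^ proj₁ p → g ∣ s U * b U ^ proj₂ p → g ∣ c U
solution-∣c U p (u , v , e) g∣raˣ g∣sbʸ =
  ℤ∣.∣⇒∣ᵤ (subst (_ ℤ∣.∣_) e (ℤ∣.∣m∣n⇒∣m+n (∣⇒∣sgn* u _ g∣raˣ) (∣⇒∣sgn* v _ g∣sbʸ)))

solution-∣s : ∀ U {g} p → Solution U p → g ∣ c U → g ∣ r U * a U ^ proj₁ p → g ∣ s U * b U ^ proj₂ p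
solution-∣s U p (u , v , e) g∣c g∣raˣ =
  ∣sgn*⇒∣ v _ (ℤ∣.∣m+n∣m⇒∣n (subst (_ ℤ∣.∣_) (sym e) (ℤ∣.∣ᵤ⇒∣ g∣c)) (∣⇒∣sgn* u _ g∣raˣ))

solution-value : ∀ U p → Solution U p → ∃[ v ] (r U * a U ^ proj₁ p ≡ ℤ.∣ + c U ℤ.- sgn v ℤ.* + (s U * b U ^ proj₂ p) ∣)
solution-value U p (u , v , e) = v , (begin
  X                                     ≡⟨ ∣sgn*∣ u (+ X) ⟨
  ℤ.∣ sgn u ℤ.* + X ∣                   ≡⟨ cong ℤ.∣_∣ (solve 2 (λ x y → x := x :+ y :- y) refl (sgn u ℤ.* + X) (sgn v ℤ.* + Y)) ⟩
  ℤ.∣ sgn u ℤ.* + X ℤ.+ sgn v ℤ.* + Y ℤ.- sgn v ℤ.* + Y ∣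
                                        ≡⟨ cong (λ z → ℤ.∣ z ℤ.- sgn v ℤ.* + Y ∣) e ⟩
  ℤ.∣ + c U ℤ.- sgn v ℤ.* + Y ∣         ∎)
  where
  open ≡-Reasoning
  open +-*-Solver
  X = r U * a U ^ proj₁ p
  Y = s U * b U ^ proj₂ p

IsSolution-÷ : ∀ (U V : SolSet) {d} p q → 0 < d →
  r U * a U ^ proj₁ p ≡ r V * a V ^ proj₁ q * d → s U * b U ^ proj₂ p ≡ s V * b V ^ proj₂ q * d →
  c U ≡ c V * d → Solution U p → Solution V q
IsSolution-÷ U V {d} p q 0<d raˣ≡ sbʸ≡ c≡c′d (u , v , e) =
  u , v , ℤ.*-cancelʳ-≡ _ (+ c V) (+ d) {{>-nonZero 0<d}} (begin
    (sgn u ℤ.* + X ℤ.+ sgn v ℤ.* + Y) ℤ.* + d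
      ≡⟨ solve 5 (λ σ τ x y δ → (σ :* x :+ τ :* y) :* δ := σ :* (x :* δ) :+ τ :* (y :* δ))
           refl (sgn u) (sgn v) (+ X) (+ Y) (+ d) ⟩
    sgn u ℤ.* (+ X ℤ.* + d) ℤ.+ sgn v ℤ.* (+ Y ℤ.* + d)
      ≡⟨ cong₂ (λ x y → sgn u ℤ.* x ℤ.+ sgn v ℤ.* y) (ℤ.pos-* X d) (ℤ.pos-* Y d) ⟨
    sgn u ℤ.* + (X * d) ℤ.+ sgn v ℤ.* + (Y * d)
      ≡⟨ cong₂ (λ x y → sgn u ℤ.* + x ℤ.+ sgn v ℤ.* + y) raˣ≡ sbʸ≡ ⟨
    sgn u ℤ.* + (r U * a U ^ proj₁ p) ℤ.+ sgn v ℤ.* + (s U * b U ^ proj₂ p)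
      ≡⟨ e ⟩
    + c U
      ≡⟨ trans (cong +_ c≡c′d) (ℤ.pos-* (c V) d) ⟩
    + c V ℤ.* + d ∎)
  where
  open ≡-Reasoning
  open +-*-Solver
  X = r V * a V ^ proj₁ q
  Y = s V * b V ^ proj₂ q

Bool-pigeonhole : ∀ {A : Set} (f : Bool → A) {x y z} →
  ∃[ u ] (x ≡ f u) → ∃[ v ] (y ≡ f v) → ∃[ w ] (z ≡ f w) → x ≡ y ⊎ x ≡ z ⊎ y ≡ z
Bool-pigeonhole f (false , x≡) (false , y≡) _ = inj₁ (trans x≡ (sym y≡))
Bool-pigeonhole f (true , x≡) (true , y≡) _ = inj₁ (trans x≡ (sym y≡))
Bool-pigeonhole f (false , x≡) (true , _) (false , z≡) = inj₂ (inj₁ (trans x≡ (sym z≡)))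
Bool-pigeonhole f (true , x≡) (false , _) (true , z≡) = inj₂ (inj₁ (trans x≡ (sym z≡)))
Bool-pigeonhole f (_ , _) (true , y≡) (true , z≡) = inj₂ (inj₂ (trans y≡ (sym z≡)))
Bool-pigeonhole f (_ , _) (false , y≡) (false , z≡) = inj₂ (inj₂ (trans y≡ (sym z≡)))

-- With y = 0 the value r a^x is |c ∓ s|, one of two numbers, and it determines x.
y≡0-solutions-≤2 : ∀ U → 1 < a U → 0 < r U → Unique (sols U) → All (Solution U) (sols U) →
  All (λ p → proj₂ p ≡ 0) (sols U) → length (sols U) ≤ 2
y≡0-solutions-≤2 (mkSolSet _ _ _ _ _ []) _ _ _ _ _ = z≤n
y≡0-solutions-≤2 (mkSolSet _ _ _ _ _ (_ ∷ [])) _ _ _ _ _ = s≤s z≤n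
y≡0-solutions-≤2 (mkSolSet _ _ _ _ _ (_ ∷ _ ∷ [])) _ _ _ _ _ = s≤s (s≤s z≤n)
y≡0-solutions-≤2 U@(mkSolSet _ _ _ _ _ ((x₁ , _) ∷ (x₂ , _) ∷ (x₃ , _) ∷ _)) 1<a 0<r
  ((p₁≢p₂ ∷ p₁≢p₃ ∷ _) ∷ (p₂≢p₃ ∷ _) ∷ _) (sol₁ ∷ sol₂ ∷ sol₃ ∷ _) (refl ∷ refl ∷ refl ∷ _)
  with Bool-pigeonhole (λ v → ℤ.∣ + c U ℤ.- sgn v ℤ.* + (s U * 1) ∣)
         (solution-value U (x₁ , 0) sol₁) (solution-value U (x₂ , 0) sol₂) (solution-value U (x₃ , 0) sol₃)
... | inj₁ e = contradiction (cong (_, 0) (*^-injective 0<r 1<a e)) p₁≢p₂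
... | inj₂ (inj₁ e) = contradiction (cong (_, 0) (*^-injective 0<r 1<a e)) p₁≢p₃
... | inj₂ (inj₂ e) = contradiction (cong (_, 0) (*^-injective 0<r 1<a e)) p₂≢p₃

∣r∣b⇒∣s : ∀ T {g} → IsSetOfSolutions T → Any (λ p → proj₂ p ≡ 0) (sols T) → g ∣ r T → g ∣ b T → g ∣ s T
∣r∣b⇒∣s T {g} (1<a , _ , _ , 0<r , _ , 2<len , L-unique , L-sols) y₀ g∣r g∣b
  with p₀ , p₀∈ , y₀≡0 ← find y₀
  with all? (λ p → proj₂ p ≟ 0) (sols T)
... | yes all-y≡0 = contradiction (y≡0-solutions-≤2 T 1<a 0<r L-unique L-sols all-y≡0) (<⇒≱ 2<len)
... | no ¬all-y≡0 with p , p∈ , y≢0 ← find (All.¬All⇒Any¬ (λ p → proj₂ p ≟ 0) (sols T) ¬all-y≡0) =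
  subst (g ∣_) (trans (cong (λ y → s T * b T ^ y) y₀≡0) (*-identityʳ (s T)))
    (solution-∣s T p₀ (All.lookup L-sols p₀∈)
      (solution-∣c T p (All.lookup L-sols p∈) (∣m⇒∣m*n (a T ^ proj₁ p) g∣r) (∣n⇒∣m*n (s T) (∣⇒∣^ y≢0 g∣b)))
      (∣m⇒∣m*n (a T ^ proj₁ p₀) g∣r))

swap : SolSet → SolSet
swap T = mkSolSet (b T) (a T) (c T) (s T) (r T) (map Product.swap (sols T))

Solution-swap : ∀ T p → Solution T p → Solution (swap T) (Product.swap p)
Solution-swap T (x , y) (u , v , e) =
  v , u , trans (ℤ.+-comm (sgn v ℤ.* + (s T * b T ^ y)) (sgn u ℤ.* + (r T * a T ^ x))) e

IsSetOfSolutions-swap : ∀ {T} → IsSetOfSolutions T → IsSetOfSolutions (swap T)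
IsSetOfSolutions-swap {T} (1<a , 1<b , 0<c , 0<r , 0<s , 2<len , L-unique , L-sols) =
  1<b , 1<a , 0<c , 0<s , 0<r , subst (2 <_) (sym (length-map Product.swap (sols T))) 2<len ,
  Unique.map⁺ (cong Product.swap) L-unique , All.map⁺ (All.map (λ {p} → Solution-swap T p) L-sols)

∣s∣a⇒∣r : ∀ T {g} → IsSetOfSolutions T → Any (λ p → proj₁ p ≡ 0) (sols T) → g ∣ s T → g ∣ a T → g ∣ r T
∣s∣a⇒∣r T valid x₀ = ∣r∣b⇒∣s (swap T) (IsSetOfSolutions-swap valid) (Any.map⁺ x₀)

Reduced : SolSet → Set
Reduced T = Coprime (r T) (s T) × Any (λ p → proj₁ p ≡ 0) (sols T) × Any (λ p → proj₂ p ≡ 0) (sols T)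

IsBasic⇒Reduced : ∀ {T} → IsBasic T → Reduced T
IsBasic⇒Reduced {T} (gcd[r,sb]≡1 , _ , x₀ , y₀ , _) =
  (λ (e∣r , e∣s) → gcd≡1⇒coprime gcd[r,sb]≡1 (e∣r , ∣m⇒∣m*n (b T) e∣s)) , x₀ , y₀

Reduced⇒IsBasic : ∀ T → IsSetOfSolutions T → Reduced T →
  ¬ IsPerfectPower (a T) → ¬ IsPerfectPower (b T) → IsBasic T
Reduced⇒IsBasic T valid (r⊥s , x₀ , y₀) a-¬perfect b-¬perfect =
  coprime⇒gcd≡1 (coprime-*ʳ r⊥s (λ (e∣r , e∣b) → r⊥s (e∣r , ∣r∣b⇒∣s T valid y₀ e∣r e∣b))) ,
  coprime⇒gcd≡1 (coprime-*ʳ (Coprime.sym r⊥s) (λ (e∣s , e∣a) → r⊥s (∣s∣a⇒∣r T valid x₀ e∣s e∣a , e∣s))) ,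
  x₀ , y₀ , a-¬perfect , b-¬perfect

ScaledPair : (M D : ℕ) (T T′ : SolSet) → ℕ × ℕ → ℕ × ℕ → Set
ScaledPair M D T T′ t q =
  M * (r T * a T ^ proj₁ t) ≡ D * (r T′ * a T′ ^ proj₁ q) ×
  M * (s T * b T ^ proj₂ t) ≡ D * (s T′ * b T′ ^ proj₂ q)

Scaled : (M D : ℕ) (T T′ : SolSet) → Set
Scaled M D T T′ = All (λ t → Any (ScaledPair M D T T′ t) (sols T′)) (sols T)

coprime-proportional⇒≡ : ∀ {M D R S R′ S′} → 0 < M → Coprime R S → Coprime R′ S′ →
  M * R ≡ D * R′ → M * S ≡ D * S′ → R ≡ R′
coprime-proportional⇒≡ {M} {D} {R} {S} {R′} {S′} 0<M R⊥S R′⊥S′ MR≡DR′ MS≡DS′ =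
  ∣-antisym (coprime-divisor R⊥S (divides S′ (trans (sym RS′≡SR′) (*-comm R S′))))
            (coprime-divisor R′⊥S′ (divides S (trans (*-comm S′ R) RS′≡SR′)))
  where
  open ≡-Reasoning
  RS′≡SR′ : R * S′ ≡ S * R′
  RS′≡SR′ = *-cancelˡ-≡ (R * S′) (S * R′) M {{>-nonZero 0<M}} (begin
    M * (R * S′)   ≡⟨ *-assoc M R S′ ⟨
    M * R * S′     ≡⟨ cong (_* S′) MR≡DR′ ⟩
    D * R′ * S′    ≡⟨ xy∙z≈xz∙y D R′ S′ ⟩
    D * S′ * R′    ≡⟨ cong (_* R′) MS≡DS′ ⟨
    M * S * R′     ≡⟨ *-assoc M S R′ ⟩
    M * (S * R′)   ∎)

Scaled-Reduced⇒≈ : ∀ {T T′ M D} → IsSetOfSolutions T → IsSetOfSolutions T′ → Reduced T → Reduced T′ →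
  a T′ ≡ a T → b T′ ≡ b T → length (sols T) ≡ length (sols T′) → 0 < M → 0 < D →
  M * c T ≡ D * c T′ → Scaled M D T T′ → T′ ≈S T
Scaled-Reduced⇒≈ {mkSolSet A B C R S L} {mkSolSet _ _ C′ R′ S′ L′} {M} {D}
  (1<A , 1<B , _ , 0<R , 0<S , _ , L-unique , _) (_ , _ , _ , 0<R′ , 0<S′ , _ , L′-unique , _)
  (R⊥S , x₀ , y₀) (R′⊥S′ , x₀′ , y₀′) refl refl len≡ 0<M 0<D MC≡DC′ scaled =
  refl , refl , C′≡C , sym R≡R′ , sym S≡S′ , Unique-⊆⇒↭ L′-unique L′⊆L (≤-reflexive len≡)
  where
  Pair = ScaledPair M D (mkSolSet A B C R S L) (mkSolSet A B C′ R′ S′ L′)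

  Pairˣ : ∀ {t q} → Pair t q → M * R * A ^ proj₁ t ≡ D * R′ * A ^ proj₁ q
  Pairˣ (eˣ , _) = trans (*-assoc M R _) (trans eˣ (sym (*-assoc D R′ _)))
  Pairʸ : ∀ {t q} → Pair t q → M * S * B ^ proj₂ t ≡ D * S′ * B ^ proj₂ q
  Pairʸ (_ , eʸ) = trans (*-assoc M S _) (trans eʸ (sym (*-assoc D S′ _)))

  Pair-injective : ∀ {t t′ q} → Pair t q → Pair t′ q → t ≡ t′
  Pair-injective {t} {t′} {q} tq t′q = cong₂ _,_
    (*^-injective (0<*⁺ 0<M 0<R) 1<A (trans (Pairˣ {t} {q} tq) (sym (Pairˣ {t′} {q} t′q))))
    (*^-injective (0<*⁺ 0<M 0<S) 1<B (trans (Pairʸ {t} {q} tq) (sym (Pairʸ {t′} {q} t′q))))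

  backward : ∀ {q} → q ∈ L′ → ∃[ t ] (t ∈ L × Pair t q)
  backward = All-Any⇒onto Pair (λ {t} {t′} {q} → Pair-injective {t} {t′} {q})
    L-unique (≤-reflexive (sym len≡)) scaled

  MR≡DR′ : M * R ≡ D * R′
  MR≡DR′
    with (_ , y) , t₀∈ , refl ← find x₀
    with q , _ , t₀q ← find (All.lookup scaled t₀∈)
    with (_ , y′) , q₀∈ , refl ← find x₀′
    with t , _ , tq₀ ← backward q₀∈
    = *^-balance {i = proj₁ q} {proj₁ t} 1<A (0<*⁺ 0<D 0<R′)
        (Pairˣ {0 , y} {q} t₀q) (Pairˣ {t} {0 , y′} tq₀)

  MS≡DS′ : M * S ≡ D * S′
  MS≡DS′
    with (x , _) , t₀∈ , refl ← find y₀
    with q , _ , t₀q ← find (All.lookup scaled t₀∈)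
    with (x′ , _) , q₀∈ , refl ← find y₀′
    with t , _ , tq₀ ← backward q₀∈
    = *^-balance {i = proj₂ q} {proj₂ t} 1<B (0<*⁺ 0<D 0<S′)
        (Pairʸ {x , 0} {q} t₀q) (Pairʸ {t} {x′ , 0} tq₀)

  R≡R′ : R ≡ R′
  R≡R′ = coprime-proportional⇒≡ {M} {D} 0<M R⊥S R′⊥S′ MR≡DR′ MS≡DS′
  M≡D : M ≡ D
  M≡D = *-cancelʳ-≡ M D R {{>-nonZero 0<R}} (trans MR≡DR′ (cong (D *_) (sym R≡R′)))
  S≡S′ : S ≡ S′
  S≡S′ = *-cancelˡ-≡ S S′ M {{>-nonZero 0<M}} (trans MS≡DS′ (cong (_* S′) (sym M≡D)))
  C′≡C : C′ ≡ C
  C′≡C = *-cancelˡ-≡ C′ C D {{>-nonZero 0<D}} (trans (sym MC≡DC′) (cong (_* C) M≡D))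

  L′⊆L : L′ ⊆ L
  L′⊆L {q} q∈ with t , t∈ , tq ← backward q∈ = subst (_∈ L) (cong₂ _,_
    (*^-injective (0<*⁺ 0<M 0<R) 1<A
      (trans (Pairˣ {t} {q} tq) (cong (λ k → k * A ^ proj₁ q) (sym (cong₂ _*_ M≡D R≡R′)))))
    (*^-injective (0<*⁺ 0<M 0<S) 1<B
      (trans (Pairʸ {t} {q} tq) (cong (λ k → k * B ^ proj₂ q) (sym (cong₂ _*_ M≡D S≡S′))))))
    t∈

rescale : ∀ r A m R d δ {a x} → a ≡ A ^ m → r * a ^ δ ≡ R * d → δ ≤ x → r * a ^ x ≡ R * A ^ (m * (x ∸ δ)) * d
rescale r A m R d δ {a} {x} a≡Aᵐ raᵟ≡Rd δ≤x = begin
  r * a ^ x                    ≡⟨ cong (λ k → r * a ^ k) (m+[n∸m]≡n δ≤x) ⟨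
  r * a ^ (δ + (x ∸ δ))        ≡⟨ cong (r *_) (^-distribˡ-+-* a δ (x ∸ δ)) ⟩
  r * (a ^ δ * a ^ (x ∸ δ))    ≡⟨ *-assoc r _ _ ⟨
  r * a ^ δ * a ^ (x ∸ δ)      ≡⟨ cong₂ _*_ raᵟ≡Rd (trans (cong (_^ (x ∸ δ)) a≡Aᵐ) (^-*-assoc A m (x ∸ δ))) ⟩
  R * d * A ^ (m * (x ∸ δ))    ≡⟨ xy∙z≈xz∙y R d _ ⟩
  R * A ^ (m * (x ∸ δ)) * d    ∎
  where open ≡-Reasoning

*∸-injective : ∀ {m δ x x′} → 0 < m → δ ≤ x → δ ≤ x′ → m * (x ∸ δ) ≡ m * (x′ ∸ δ) → x ≡ x′
*∸-injective {m} {δ} {x} {x′} 0<m δ≤x δ≤x′ e =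
  trans (sym (m∸n+n≡m δ≤x)) (trans (cong (_+ δ) (*-cancelˡ-≡ (x ∸ δ) (x′ ∸ δ) m {{>-nonZero 0<m}} e)) (m∸n+n≡m δ≤x′))

module Normalisation (S₀ : SolSet) (1<a : 1 < a S₀) (1<b : 1 < b S₀) (0<c : 0 < c S₀) (0<r : 0 < r S₀)
  (0<s : 0 < s S₀) (2<len : 2 < length (sols S₀)) (L-unique : Unique (sols S₀))
  (L-sols : All (Solution S₀) (sols S₀)) where

  private
    L = sols S₀
    0<len : 0 < length L
    0<len = <-trans z<s (<-trans (s≤s z<s) 2<len)

  open PrimitiveBase (primitiveBase 1<a) renaming
    (base to A; exponent to m; 1<base to 1<A; 0<exponent to 0<m; n≡base^exponent to a≡Aᵐ; base-¬perfect to A-¬perfect)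
  open PrimitiveBase (primitiveBase 1<b) renaming
    (base to B; exponent to n; 1<base to 1<B; 0<exponent to 0<n; n≡base^exponent to b≡Bⁿ; base-¬perfect to B-¬perfect)
  open Minimiser (minimiser proj₁ L 0<len) renaming (point to pˣ; point∈ to pˣ∈; minimal to δ-minimal)
  open Minimiser (minimiser proj₂ L 0<len) renaming (point to pʸ; point∈ to pʸ∈; minimal to ε-minimal)

  δ ε : ℕ
  δ = proj₁ pˣ
  ε = proj₂ pʸ

  0<raᵟ : 0 < r S₀ * a S₀ ^ δ
  0<raᵟ = 0<*⁺ 0<r (m^n>0 (a S₀) {{>-nonZero (<-trans z<s 1<a)}} δ)

  open CoprimeSplit (coprimeSplit (r S₀ * a S₀ ^ δ) (s S₀ * b S₀ ^ ε) 0<raᵟ) renaming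
    (m′ to R; n′ to S; m≡m′*d to raᵟ≡Rd; n≡n′*d to sbᵋ≡Sd; m′⊥n′ to R⊥S)

  φ : ℕ × ℕ → ℕ × ℕ
  φ p = m * (proj₁ p ∸ δ) , n * (proj₂ p ∸ ε)

  raˣ≡ : ∀ {p} → p ∈ L → r S₀ * a S₀ ^ proj₁ p ≡ R * A ^ proj₁ (φ p) * d
  raˣ≡ p∈ = rescale (r S₀) A m R d δ a≡Aᵐ raᵟ≡Rd (All.lookup δ-minimal p∈)

  sbʸ≡ : ∀ {p} → p ∈ L → s S₀ * b S₀ ^ proj₂ p ≡ S * B ^ proj₂ (φ p) * d
  sbʸ≡ p∈ = rescale (s S₀) B n S d ε b≡Bⁿ sbᵋ≡Sd (All.lookup ε-minimal p∈)

  open _∣_ (solution-∣c S₀ pˣ (All.lookup L-sols pˣ∈)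
    (divides (R * A ^ proj₁ (φ pˣ)) (raˣ≡ pˣ∈)) (divides (S * B ^ proj₂ (φ pˣ)) (sbʸ≡ pˣ∈)))
    renaming (quotient to C; equality to c≡Cd)

  T : SolSet
  T = mkSolSet A B C R S (map φ L)

  valid-T : IsSetOfSolutions T
  valid-T =
    1<A , 1<B , 0<*⁻ (subst (0 <_) c≡Cd 0<c) , 0<*⁻ (subst (0 <_) raᵟ≡Rd 0<raᵟ) ,
    0<*⁻ (subst (0 <_) sbᵋ≡Sd (0<*⁺ 0<s (m^n>0 (b S₀) {{>-nonZero (<-trans z<s 1<b)}} ε))) ,
    subst (2 <_) (sym (length-map φ L)) 2<len ,
    Unique-map⁺-∈ φ (λ p∈ q∈ φp≡φq → cong₂ _,_
      (*∸-injective 0<m (All.lookup δ-minimal p∈) (All.lookup δ-minimal q∈) (cong proj₁ φp≡φq))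
      (*∸-injective 0<n (All.lookup ε-minimal p∈) (All.lookup ε-minimal q∈) (cong proj₂ φp≡φq))) L-unique ,
    All.map⁺ (All.tabulate λ {p} p∈ →
      IsSolution-÷ S₀ T p (φ p) 0<d (raˣ≡ p∈) (sbʸ≡ p∈) c≡Cd (All.lookup L-sols p∈))

  reduced-T : Reduced T
  reduced-T =
    R⊥S , Any.map⁺ (lose pˣ∈ (trans (cong (m *_) (n∸n≡0 δ)) (*-zeroʳ m))) ,
          Any.map⁺ (lose pʸ∈ (trans (cong (n *_) (n∸n≡0 ε)) (*-zeroʳ n)))

  basic-T : IsBasic T
  basic-T = Reduced⇒IsBasic T valid-T reduced-T A-¬perfect B-¬perfect

  S₀~T : SameFamily S₀ T
  S₀~T = via (reciprocal d 0<d)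
    where
    via : ∃[ k ] (Positive k × ∀ {u v} → u ≡ v * d → k ℚ.* toℚ u ≡ toℚ v) → SameFamily S₀ T
    via (k , k>0 , k-scales) =
      sym (length-map φ L) , (A , m , 1 , a≡Aᵐ , sym (^-identityʳ A)) , (B , n , 1 , b≡Bⁿ , sym (^-identityʳ B)) ,
      k , k>0 , k-scales {v = C} c≡Cd ,
      All.tabulate (λ {p} p∈ → Any.map⁺ (lose p∈
        (k-scales {v = R * A ^ proj₁ (φ p)} (raˣ≡ p∈) , k-scales {v = S * B ^ proj₂ (φ p)} (sbʸ≡ p∈))))

  unique-T : (T′ : SolSet) → IsSetOfSolutions T′ → SameFamily S₀ T′ → IsBasic T′ → T′ ≈S T
  unique-T T′ valid′@(1<a′ , 1<b′ , _) (len≡ , a~a′ , b~b′ , k , k>0 , kc≡c′ , related)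
    basic′@(_ , _ , _ , _ , a′-¬perfect , b′-¬perfect) = via (positive-ratio k k>0)
    where
    via : ∃[ N ] ∃[ D ] (0 < N × 0 < D × ∀ {u v} → k ℚ.* toℚ u ≡ toℚ v → N * u ≡ D * v) → T′ ≈S T
    via (N , D , 0<N , 0<D , N/D) =
      Scaled-Reduced⇒≈ valid-T valid′ reduced-T (IsBasic⇒Reduced {T′} basic′)
        (PowersOfOne⇒≡base (primitiveBase 1<a) 1<a′ a′-¬perfect a~a′)
        (PowersOfOne⇒≡base (primitiveBase 1<b) 1<b′ b′-¬perfect b~b′)
        (trans (length-map φ L) len≡) (0<*⁺ 0<N 0<d) 0<D (rescaled {w = C} c≡Cd (N/D kc≡c′))
        (All.map⁺ (All.tabulate λ {p} p∈ → Any.map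
          (λ (eˣ , eʸ) → rescaled {w = R * A ^ proj₁ (φ p)} (raˣ≡ p∈) (N/D eˣ) ,
                         rescaled {w = S * B ^ proj₂ (φ p)} (sbʸ≡ p∈) (N/D eʸ))
          (All.lookup related p∈)))
      where
      rescaled : ∀ {u v w} → u ≡ w * d → N * u ≡ D * v → N * d * w ≡ D * v
      rescaled {u} {v} {w} u≡wd Nu≡Dv =
        trans (*-assoc N d w) (trans (cong (N *_) (trans (*-comm d w) (sym u≡wd))) Nu≡Dv)

lemma1 : (S : SolSet) → IsSetOfSolutions S →
    ∃[ T ] (IsSetOfSolutions T × SameFamily S T × IsBasic T ×
    ((T′ : SolSet) → IsSetOfSolutions T′ → SameFamily S T′ → IsBasic T′ → T′ ≈S T))
lemma1 S (1<a , 1<b , 0<c , 0<r , 0<s , 2<len , L-unique , L-sols) =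
  T , valid-T , S₀~T , basic-T , unique-T
  where
  open Normalisation S 1<a 1<b 0<c 0<r 0<s 2<len L-unique L-sols using (T; valid-T; S₀~T; basic-T; unique-T)
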